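{- For every integer $n \geq 6$, $c(\Gamma_n) \leq \left\lceil \frac{n}{3} \right\rceil$, where $\Gamma_n$ is the $n$-dimensional Fibonacci cube.
   Context: The $n$-dimensional Fibonacci cube $\Gamma_n$ is the subgraph of the hypercube $Q_n$ (vertex set $\{0,1\}^n$, adjacency = differing in exactly one position) induced by all binary strings of length $n$ containing no two consecutive 1's. Cops and Robbers on a finite simple graph $G$ with $k$ cops: cops choose starting vertices, then the robber; each round all cops move then the robber moves, each to a neighbor or staying put; cops win if a cop occupies the robber's vertex, otherwise the robber wins. The cop number $c(G)$ is the minimum $k$ for which the cops can guarantee capture. -}

module Defs where

open import Data.Nat using (ℕ; zero; suc; _+_; _≤_)
open import Data.Nat.DivMod using (_/_)
open import Data.Bool using (Bool; true; false; _∧_; not; T)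
open import Data.Vec using (Vec; []; _∷_)
open import Data.Fin using (Fin)
open import Data.Product using (Σ; ∃; ∃-syntax; _×_; _,_; proj₁)
open import Data.Sum using (_⊎_)
open import Relation.Binary.PropositionalEquality using (_≡_)

record Graph : Set₁ where
  field
    V   : Set
    Adj : V → V → Set

module _ (G : Graph) where
  open Graph G

  Move : V → V → Set
  Move x y = x ≡ y ⊎ Adj x y

  Cops : ℕ → Set
  Cops k = Fin k → V

  Caught : ∀ {k} → Cops k → V → Set
  Caught c r = ∃[ i ] c i ≡ r

  -- Inductive (well-founded) = capture is guaranteed in finitely many rounds.
  data CopTurn {k : ℕ} : Cops k → V → Set
  data RobTurn {k : ℕ} : Cops k → V → Set

  data CopTurn {k} where
    caughtC : ∀ {c r} → Caught c r → CopTurn c r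
    cmove   : ∀ {c r} (c' : Cops k) → (∀ i → Move (c i) (c' i)) →
              RobTurn c' r → CopTurn c r

  data RobTurn {k} where
    caughtR : ∀ {c r} → Caught c r → RobTurn c r
    rmove   : ∀ {c r} → (∀ r' → Move r r' → CopTurn c r') → RobTurn c r

  CopsWin : ℕ → Set
  CopsWin k = Σ (Cops k) λ c₀ → ∀ r₀ → CopTurn c₀ r₀

  CopNumber≤ : ℕ → Set
  CopNumber≤ m = ∃[ k ] (k ≤ m × CopsWin k)

hamming : ∀ {n} → Vec Bool n → Vec Bool n → ℕ
hamming []       []       = 0
hamming (x ∷ xs) (y ∷ ys) with x | y
... | true  | true  = hamming xs ys
... | false | false = hamming xs ys
... | _     | _     = suc (hamming xs ys)

noConsec : ∀ {n} → Vec Bool n → Bool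
noConsec []               = true
noConsec (x ∷ [])         = true
noConsec (x ∷ (y ∷ ys))   = not (x ∧ y) ∧ noConsec (y ∷ ys)

FibVertex : ℕ → Set
FibVertex n = Σ (Vec Bool n) (λ v → T (noConsec v))

Fib : ℕ → Graph
Fib n = record
  { V   = FibVertex n
  ; Adj = λ u v → hamming (proj₁ u) (proj₁ v) ≡ 1
  }

⌈_/3⌉ : ℕ → ℕ
⌈ n /3⌉ = (n + 2) / 3

{-# OPTIONS --safe #-}
-- Cop i < ⌈n/3⌉ guards the window of positions 3i, 3i+1, 3i+2. Its target is the robber's
-- shadow, the robber's string with that window cleared, which is again a vertex of Γₙ; each
-- round the cop captures the robber if it can and otherwise steps along a geodesic towards
-- the shadow. A robber move outside the window shifts the shadow by one but keeps the robber's
-- weight w in the window, and a move inside it keeps the shadow fixed, so 2·d(cop, shadow) +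
-- (2 − w) never increases and it drops for the cop whose window the robber moved in. If the
-- robber stays put it drops for every cop off its shadow, and the cops of the windows [0,3)
-- and [3,6) cannot both be on their shadows: the uncaught robber would then read 101101 there.
-- So the total potential decreases every round and the robber is caught.
module Submission where

open import Defs
open import Data.Bool using (Bool; true; false; T; b≤b; f≤t) renaming (_≤_ to _≤ᵇ_)
open import Data.Bool.Properties using (T-irrelevant; ≤-minimum) renaming (≤-refl to ≤ᵇ-refl)
open import Data.Empty using (⊥; ⊥-elim)
open import Data.Fin using (Fin; zero; suc; toℕ; fromℕ<)
open import Data.Fin.Properties using (any?; toℕ-fromℕ<)
open import Data.Nat using (ℕ; zero; suc; _+_; _*_; _∸_; _≤_; _<_; z≤n; s≤s; _≤?_; _<?_; +-0-rawMonoid)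
open import Data.Nat.DivMod using (_/_; _%_; m≡m%n+[m/n]*n; m%n<n; m/n*n≤m; m<n*o⇒m/o<n)
open import Data.Nat.Properties
open import Data.Product using (∃-syntax; _×_; _,_; proj₁; proj₂)
open import Data.Sum using (_⊎_; inj₁; inj₂)
open import Data.Vec using (Vec; []; _∷_; _++_; replicate)
open import Data.Vec.Functional using (Vector)
open import Data.Vec.Relation.Binary.Pointwise.Inductive as Pointwise using (Pointwise; []; _∷_)
open import Function using (_∘_)
open import Relation.Binary.PropositionalEquality
open import Relation.Nullary using (¬_; yes; no)
open import Algebra.Definitions.RawMonoid +-0-rawMonoid using (sum)

hamming-cons-same : ∀ {n} a (xs ys : Vec Bool n) → hamming (a ∷ xs) (a ∷ ys) ≡ hamming xs ys
hamming-cons-same true  xs ys = refl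
hamming-cons-same false xs ys = refl

hamming-refl : ∀ {n} (xs : Vec Bool n) → hamming xs xs ≡ 0
hamming-refl []       = refl
hamming-refl (x ∷ xs) = trans (hamming-cons-same x xs xs) (hamming-refl xs)

hamming-sym : ∀ {n} (xs ys : Vec Bool n) → hamming xs ys ≡ hamming ys xs
hamming-sym []           []           = refl
hamming-sym (true  ∷ xs) (true  ∷ ys) = hamming-sym xs ys
hamming-sym (true  ∷ xs) (false ∷ ys) = cong suc (hamming-sym xs ys)
hamming-sym (false ∷ xs) (true  ∷ ys) = cong suc (hamming-sym xs ys)
hamming-sym (false ∷ xs) (false ∷ ys) = hamming-sym xs ys

hamming≡0⇒≡ : ∀ {n} {xs ys : Vec Bool n} → hamming xs ys ≡ 0 → xs ≡ ys
hamming≡0⇒≡ {xs = []}         {[]}         _ = refl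
hamming≡0⇒≡ {xs = true  ∷ xs} {true  ∷ ys} e = cong (true ∷_) (hamming≡0⇒≡ e)
hamming≡0⇒≡ {xs = false ∷ xs} {false ∷ ys} e = cong (false ∷_) (hamming≡0⇒≡ e)

hamming-++ : ∀ {m n} (xs ys : Vec Bool m) (us vs : Vec Bool n) →
             hamming (xs ++ us) (ys ++ vs) ≡ hamming xs ys + hamming us vs
hamming-++ []           []           us vs = refl
hamming-++ (true  ∷ xs) (true  ∷ ys) us vs = hamming-++ xs ys us vs
hamming-++ (true  ∷ xs) (false ∷ ys) us vs = cong suc (hamming-++ xs ys us vs)
hamming-++ (false ∷ xs) (true  ∷ ys) us vs = cong suc (hamming-++ xs ys us vs)
hamming-++ (false ∷ xs) (false ∷ ys) us vs = hamming-++ xs ys us vs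

hamming-cons : ∀ {n} a b (xs ys : Vec Bool n) →
               hamming (a ∷ xs) (b ∷ ys) ≡ hamming (a ∷ []) (b ∷ []) + hamming xs ys
hamming-cons a b = hamming-++ (a ∷ []) (b ∷ [])

hamming≤length : ∀ {n} (xs ys : Vec Bool n) → hamming xs ys ≤ n
hamming≤length []           []           = z≤n
hamming≤length (true  ∷ xs) (true  ∷ ys) = m≤n⇒m≤1+n (hamming≤length xs ys)
hamming≤length (true  ∷ xs) (false ∷ ys) = s≤s (hamming≤length xs ys)
hamming≤length (false ∷ xs) (true  ∷ ys) = s≤s (hamming≤length xs ys)
hamming≤length (false ∷ xs) (false ∷ ys) = m≤n⇒m≤1+n (hamming≤length xs ys)

hamming-triangle : ∀ {n} (xs ys zs : Vec Bool n) → hamming xs zs ≤ hamming xs ys + hamming ys zs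
hamming-triangle []       []       []       = z≤n
hamming-triangle (x ∷ xs) (y ∷ ys) (z ∷ zs) = bit x y z (hamming-triangle xs ys zs)
  where
  bit : ∀ x y z → hamming xs zs ≤ hamming xs ys + hamming ys zs →
        hamming (x ∷ xs) (z ∷ zs) ≤ hamming (x ∷ xs) (y ∷ ys) + hamming (y ∷ ys) (z ∷ zs)
  bit true  true  true  le = le
  bit true  true  false le = ≤-trans (s≤s le) (≤-reflexive (sym (+-suc _ _)))
  bit true  false true  le = ≤-trans le (+-mono-≤ (n≤1+n _) (n≤1+n _))
  bit true  false false le = s≤s le
  bit false true  true  le = s≤s le
  bit false true  false le = ≤-trans le (+-mono-≤ (n≤1+n _) (n≤1+n _))
  bit false false true  le = ≤-trans (s≤s le) (≤-reflexive (sym (+-suc _ _)))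
  bit false false false le = le

adjacent-∷ : ∀ {n} a b (xs ys : Vec Bool n) → hamming (a ∷ xs) (b ∷ ys) ≡ 1 →
             (a ≡ b × hamming xs ys ≡ 1) ⊎ (a ≢ b × xs ≡ ys)
adjacent-∷ true  true  xs ys e = inj₁ (refl , e)
adjacent-∷ false false xs ys e = inj₁ (refl , e)
adjacent-∷ true  false xs ys e = inj₂ ((λ ()) , hamming≡0⇒≡ {xs = xs} {ys} (suc-injective e))
adjacent-∷ false true  xs ys e = inj₂ ((λ ()) , hamming≡0⇒≡ {xs = xs} {ys} (suc-injective e))

adjacent⇒hamming≢ : ∀ {n} (xs ys zs : Vec Bool n) → hamming xs ys ≡ 1 →
                    hamming xs zs ≢ hamming ys zs
adjacent⇒hamming≢ []           []           []           ()
adjacent⇒hamming≢ (true  ∷ xs) (true  ∷ ys) (true  ∷ zs) e = adjacent⇒hamming≢ xs ys zs e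
adjacent⇒hamming≢ (true  ∷ xs) (true  ∷ ys) (false ∷ zs) e = adjacent⇒hamming≢ xs ys zs e ∘ suc-injective
adjacent⇒hamming≢ (false ∷ xs) (false ∷ ys) (true  ∷ zs) e = adjacent⇒hamming≢ xs ys zs e ∘ suc-injective
adjacent⇒hamming≢ (false ∷ xs) (false ∷ ys) (false ∷ zs) e = adjacent⇒hamming≢ xs ys zs e
adjacent⇒hamming≢ (true  ∷ xs) (false ∷ ys) (true  ∷ zs) e q
  with refl ← hamming≡0⇒≡ {xs = xs} {ys} (suc-injective e) = 1+n≢n (sym q)
adjacent⇒hamming≢ (true  ∷ xs) (false ∷ ys) (false ∷ zs) e q
  with refl ← hamming≡0⇒≡ {xs = xs} {ys} (suc-injective e) = 1+n≢n q
adjacent⇒hamming≢ (false ∷ xs) (true  ∷ ys) (true  ∷ zs) e q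
  with refl ← hamming≡0⇒≡ {xs = xs} {ys} (suc-injective e) = 1+n≢n q
adjacent⇒hamming≢ (false ∷ xs) (true  ∷ ys) (false ∷ zs) e q
  with refl ← hamming≡0⇒≡ {xs = xs} {ys} (suc-injective e) = 1+n≢n (sym q)

NoConsec : ∀ {n} → Vec Bool n → Set
NoConsec v = T (noConsec v)

NoConsec-tail : ∀ {n} a (v : Vec Bool n) → NoConsec (a ∷ v) → NoConsec v
NoConsec-tail _     []          _  = _
NoConsec-tail false (_ ∷ _)     nc = nc
NoConsec-tail true  (false ∷ _) nc = nc

NoConsec-antitone : ∀ {n} {u v : Vec Bool n} → Pointwise _≤ᵇ_ u v → NoConsec v → NoConsec u
NoConsec-antitone {u = []}               _                 _  = _
NoConsec-antitone {u = _ ∷ []}           _                 _  = _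
NoConsec-antitone {u = true ∷ true ∷ _}  (b≤b ∷ b≤b ∷ _)   ()
NoConsec-antitone {u = true ∷ false ∷ _} {b ∷ v} (_ ∷ u≤v) nc = NoConsec-antitone u≤v (NoConsec-tail b v nc)
NoConsec-antitone {u = false ∷ _ ∷ _}    {b ∷ v} (_ ∷ u≤v) nc = NoConsec-antitone u≤v (NoConsec-tail b v nc)

NoConsec-zeros : ∀ n → NoConsec (replicate n false)
NoConsec-zeros zero          = _
NoConsec-zeros (suc zero)    = _
NoConsec-zeros (suc (suc n)) = NoConsec-zeros (suc n)

record StepToward {n} (t u u' : Vec Bool n) : Set where
  constructor step
  field
    adjacent : hamming u u' ≡ 1
    closer   : suc (hamming u' t) ≡ hamming u t

StepToward-∷ : ∀ {n} a b {t u u' : Vec Bool n} →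
               StepToward t u u' → StepToward (b ∷ t) (a ∷ u) (a ∷ u')
StepToward-∷ true  true  (step adj closer) = step adj closer
StepToward-∷ false false (step adj closer) = step adj closer
StepToward-∷ true  false (step adj closer) = step adj (cong suc closer)
StepToward-∷ false true  (step adj closer) = step adj (cong suc closer)

clearSurplusBit : ∀ {n} (u t : Vec Bool n) →
                  Pointwise _≤ᵇ_ u t ⊎ ∃[ u' ] Pointwise _≤ᵇ_ u' u × StepToward t u u'
clearSurplusBit []           []           = inj₁ []
clearSurplusBit (true  ∷ us) (false ∷ ts) =
  inj₂ (false ∷ us , f≤t ∷ Pointwise.refl ≤ᵇ-refl , step (cong suc (hamming-refl us)) refl)
clearSurplusBit (true  ∷ us) (true  ∷ ts) with clearSurplusBit us ts
... | inj₁ u≤t             = inj₁ (b≤b ∷ u≤t)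
... | inj₂ (u' , u'≤u , s) = inj₂ (true ∷ u' , b≤b ∷ u'≤u , StepToward-∷ true true s)
clearSurplusBit (false ∷ us) (b     ∷ ts) with clearSurplusBit us ts
... | inj₁ u≤t             = inj₁ (≤-minimum b ∷ u≤t)
... | inj₂ (u' , u'≤u , s) = inj₂ (false ∷ u' , b≤b ∷ u'≤u , StepToward-∷ false b s)

setMissingBit : ∀ {n} {u t : Vec Bool n} → Pointwise _≤ᵇ_ u t →
                u ≡ t ⊎ ∃[ u' ] Pointwise _≤ᵇ_ u' t × StepToward t u u'
setMissingBit []                           = inj₁ refl
setMissingBit {u = false ∷ us} (f≤t ∷ u≤t) =
  inj₂ (true ∷ us , b≤b ∷ u≤t , step (cong suc (hamming-refl us)) refl)
setMissingBit {u = a ∷ _}      (b≤b ∷ u≤t) with setMissingBit u≤t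
... | inj₁ refl            = inj₁ refl
... | inj₂ (u' , u'≤t , s) = inj₂ (a ∷ u' , b≤b ∷ u'≤t , StepToward-∷ a a s)

dist : ∀ {n} → FibVertex n → FibVertex n → ℕ
dist x y = hamming (proj₁ x) (proj₁ y)

-- Clear a 1 of x that t lacks or, if there is none, set a 1 of t that x lacks: the
-- new string lies below x or below t, so it is again a vertex of Γₙ.
stepToward : ∀ {n} (x t : FibVertex n) → ∃[ x' ] Move (Fib n) x x' × dist x' t ≡ dist x t ∸ 1
stepToward (u , nc) (t , nct) with clearSurplusBit u t
... | inj₂ (u' , u'≤u , step adj closer) =
  (u' , NoConsec-antitone u'≤u nc) , inj₂ adj , cong (_∸ 1) closer
... | inj₁ u≤t with setMissingBit u≤t
...   | inj₂ (u' , u'≤t , step adj closer) =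
  (u' , NoConsec-antitone u'≤t nct) , inj₂ adj , cong (_∸ 1) closer
...   | inj₁ refl =
  (u , nc) , inj₁ refl , trans (hamming-refl u) (cong (_∸ 1) (sym (hamming-refl u)))

FibVertex-≡ : ∀ {n} {x y : FibVertex n} → proj₁ x ≡ proj₁ y → x ≡ y
FibVertex-≡ {x = v , nc} {.v , nc'} refl = cong (v ,_) (T-irrelevant nc nc')

close⇒Move : ∀ {n} {x y : FibVertex n} → dist x y ≤ 1 → Move (Fib n) x y
close⇒Move {x = x} {y} close with n≤1⇒n≡0∨n≡1 close
... | inj₁ x≡y = inj₁ (FibVertex-≡ (hamming≡0⇒≡ {xs = proj₁ x} x≡y))
... | inj₂ adj = inj₂ adj

Move⇒dist≤1 : ∀ {n} {x y : FibVertex n} → Move (Fib n) x y → dist x y ≤ 1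
Move⇒dist≤1 {x = x} (inj₁ refl) = ≤-trans (≤-reflexive (hamming-refl (proj₁ x))) z≤n
Move⇒dist≤1         (inj₂ adj)  = ≤-reflexive adj

zeroWindow : ∀ {n} → ℕ → ℕ → Vec Bool n → Vec Bool n
zeroWindow zero    zero    v       = v
zeroWindow _       _       []      = []
zeroWindow zero    (suc l) (_ ∷ v) = false ∷ zeroWindow zero l v
zeroWindow (suc s) l       (a ∷ v) = a ∷ zeroWindow s l v

zeroWindow-≤ : ∀ {n} s l (v : Vec Bool n) → Pointwise _≤ᵇ_ (zeroWindow s l v) v
zeroWindow-≤ zero    zero    v       = Pointwise.refl ≤ᵇ-refl
zeroWindow-≤ zero    (suc l) []      = []
zeroWindow-≤ zero    (suc l) (a ∷ v) = ≤-minimum a ∷ zeroWindow-≤ zero l v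
zeroWindow-≤ (suc s) l       []      = []
zeroWindow-≤ (suc s) l       (a ∷ v) = ≤ᵇ-refl ∷ zeroWindow-≤ s l v

zeroWindow-nonexpansive : ∀ {n} s l (x y : Vec Bool n) →
                          hamming (zeroWindow s l x) (zeroWindow s l y) ≤ hamming x y
zeroWindow-nonexpansive zero    zero    x       y       = ≤-refl
zeroWindow-nonexpansive zero    (suc l) []      []      = z≤n
zeroWindow-nonexpansive zero    (suc l) (a ∷ x) (b ∷ y) rewrite hamming-cons a b x y =
  ≤-trans (zeroWindow-nonexpansive zero l x y) (m≤n+m _ _)
zeroWindow-nonexpansive (suc s) l       []      []      = z≤n
zeroWindow-nonexpansive (suc s) l       (a ∷ x) (b ∷ y)
  rewrite hamming-cons a b (zeroWindow s l x) (zeroWindow s l y) | hamming-cons a b x y =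
  +-monoʳ-≤ _ (zeroWindow-nonexpansive s l x y)

zeroWindow-adjacent : ∀ {n} s l {x y : Vec Bool n} → hamming x y ≡ 1 →
                      zeroWindow s l x ≡ zeroWindow s l y ⊎
                      hamming x (zeroWindow s l x) ≡ hamming y (zeroWindow s l y)
zeroWindow-adjacent zero zero {x} {y} _ = inj₂ (trans (hamming-refl x) (sym (hamming-refl y)))
zeroWindow-adjacent zero (suc l) {[]} {[]} ()
zeroWindow-adjacent zero (suc l) {a ∷ x} {b ∷ y} adj with adjacent-∷ a b x y adj
... | inj₂ (_ , refl) = inj₁ refl
... | inj₁ (refl , adj') with zeroWindow-adjacent zero l adj'
...   | inj₁ same = inj₁ (cong (false ∷_) same)
...   | inj₂ same rewrite hamming-cons a false x (zeroWindow zero l x)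
                        | hamming-cons a false y (zeroWindow zero l y) = inj₂ (cong (_ +_) same)
zeroWindow-adjacent (suc s) l {[]} {[]} ()
zeroWindow-adjacent (suc s) l {a ∷ x} {b ∷ y} adj with adjacent-∷ a b x y adj
... | inj₂ (_ , refl) = inj₂ (trans (hamming-cons-same a x _) (sym (hamming-cons-same b x _)))
... | inj₁ (refl , adj') with zeroWindow-adjacent s l adj'
...   | inj₁ same = inj₁ (cong (a ∷_) same)
...   | inj₂ same = inj₂ (trans (hamming-cons-same a x _) (trans same (sym (hamming-cons-same a y _))))

adjacent⇒flipPosition : ∀ {n} {x y : Vec Bool n} → hamming x y ≡ 1 →
  ∃[ p ] p < n × (∀ s l → s ≤ p → p < s + l → zeroWindow s l x ≡ zeroWindow s l y)
adjacent⇒flipPosition {x = []} {[]} ()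
adjacent⇒flipPosition {x = a ∷ x} {b ∷ y} adj with adjacent-∷ a b x y adj
... | inj₂ (_ , refl) = 0 , s≤s z≤n , λ { zero (suc l) _ _ → refl }
... | inj₁ (refl , adj') with adjacent⇒flipPosition adj'
...   | p , p<n , flipInside = suc p , s≤s p<n , inside
  where
  inside : ∀ s l → s ≤ suc p → suc p < s + l → zeroWindow s l (a ∷ x) ≡ zeroWindow s l (a ∷ y)
  inside zero    (suc l) _         (s≤s p<l)   = cong (false ∷_) (flipInside zero l z≤n p<l)
  inside (suc s) l       (s≤s s≤p) (s≤s p<s+l) = cong (a ∷_) (flipInside s l s≤p p<s+l)

weight : ∀ {n} → ℕ → Vec Bool n → ℕ
weight s r = hamming r (zeroWindow s 3 r)

weight-∷ : ∀ {n} s a (r : Vec Bool n) → weight (suc s) (a ∷ r) ≡ weight s r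
weight-∷ s a r = hamming-cons-same a r (zeroWindow s 3 r)

weight-prefix : ∀ {n} a b c (r : Vec Bool n) →
                weight 0 (a ∷ b ∷ c ∷ r) ≡ hamming (a ∷ b ∷ c ∷ []) (replicate 3 false)
weight-prefix a b c r = begin
  hamming (a ∷ b ∷ c ∷ r) (false ∷ false ∷ false ∷ r)         ≡⟨ hamming-++ (a ∷ b ∷ c ∷ []) _ r r ⟩
  hamming (a ∷ b ∷ c ∷ []) (replicate 3 false) + hamming r r ≡⟨ cong (_ +_) (hamming-refl r) ⟩
  hamming (a ∷ b ∷ c ∷ []) (replicate 3 false) + 0           ≡⟨ +-identityʳ _ ⟩
  hamming (a ∷ b ∷ c ∷ []) (replicate 3 false)               ∎
  where open ≡-Reasoning

weight≤2 : ∀ {n} s (r : Vec Bool n) → NoConsec r → weight s r ≤ 2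
weight≤2 (suc s) []              _  = z≤n
weight≤2 (suc s) (a ∷ r)         nc rewrite weight-∷ s a r = weight≤2 s r (NoConsec-tail a r nc)
weight≤2 zero    []              _  = z≤n
weight≤2 zero    (a ∷ [])        _  = ≤-trans (hamming≤length (a ∷ []) _) (s≤s z≤n)
weight≤2 zero    (a ∷ b ∷ [])    _  = hamming≤length (a ∷ b ∷ []) _
weight≤2 zero    (a ∷ b ∷ c ∷ r) nc rewrite weight-prefix a b c r = bits a b c nc
  where
  bits : ∀ a b c → NoConsec (a ∷ b ∷ c ∷ r) → hamming (a ∷ b ∷ c ∷ []) (replicate 3 false) ≤ 2
  bits true  true  _     ()
  bits false true  true  ()
  bits true  false true  _ = ≤-refl
  bits true  false false _ = s≤s z≤n
  bits false true  false _ = s≤s z≤n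
  bits false false true  _ = s≤s z≤n
  bits false false false _ = z≤n

heavyWindow : ∀ {n} a b c (r : Vec Bool n) → NoConsec (a ∷ b ∷ c ∷ r) →
              2 ≤ weight 0 (a ∷ b ∷ c ∷ r) → a ≡ true × c ≡ true
heavyWindow a b c r nc heavy = bits a b c nc (subst (2 ≤_) (weight-prefix a b c r) heavy)
  where
  bits : ∀ a b c → NoConsec (a ∷ b ∷ c ∷ r) → 2 ≤ hamming (a ∷ b ∷ c ∷ []) (replicate 3 false) →
         a ≡ true × c ≡ true
  bits true  true  _     ()
  bits false true  true  ()
  bits true  false true  _ _        = refl , refl
  bits true  false false _ (s≤s ())
  bits false true  false _ (s≤s ())
  bits false false true  _ (s≤s ())
  bits false false false _ ()

¬heavyWindows₀₃ : ∀ {n} → 6 ≤ n → (r : Vec Bool n) → NoConsec r →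
                  2 ≤ weight 0 r → 2 ≤ weight 3 r → ⊥
¬heavyWindows₀₃ (s≤s (s≤s (s≤s (s≤s (s≤s (s≤s _)))))) (a ∷ b ∷ c ∷ d ∷ e ∷ f ∷ r) nc heavy₀ heavy₃ =
  consecutiveOnes (subst₂ (λ c d → NoConsec (c ∷ d ∷ e ∷ f ∷ r)) c≡true d≡true nc₂)
  where
  nc₂ : NoConsec (c ∷ d ∷ e ∷ f ∷ r)
  nc₂ = NoConsec-tail b (c ∷ d ∷ e ∷ f ∷ r) (NoConsec-tail a (b ∷ c ∷ d ∷ e ∷ f ∷ r) nc)
  c≡true : c ≡ true
  c≡true = proj₂ (heavyWindow a b c _ nc heavy₀)
  d≡true : d ≡ true
  d≡true = proj₁ (heavyWindow d e f r (NoConsec-tail c (d ∷ e ∷ f ∷ r) nc₂)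
    (subst (2 ≤_) (trans (weight-∷ 2 a _) (trans (weight-∷ 1 b _) (weight-∷ 0 c _))) heavy₃))
  consecutiveOnes : NoConsec (true ∷ true ∷ e ∷ f ∷ r) → ⊥
  consecutiveOnes ()

-- The cop's distance d to its shadow counts twice so that one step towards the shadow
-- outweighs a unit change of the robber's window weight w; on Γₙ w ≤ 2, so 2 ∸ w is exact.
potential : ℕ → ℕ → ℕ
potential d w = d * 2 + (2 ∸ w)

potential-monoˡ-≤ : ∀ {d d'} w → d' ≤ d → potential d' w ≤ potential d w
potential-monoˡ-≤ w d'≤d = +-monoˡ-≤ (2 ∸ w) (*-monoˡ-≤ 2 d'≤d)

potential-step : ∀ d {w w'} → w ≤ suc w' → potential d w' < potential (suc d) w
potential-step d {w} {w'} w≤1+w' = s≤s (begin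
  d * 2 + (2 ∸ w')      ≤⟨ +-monoʳ-≤ (d * 2) (2∸-step w≤1+w') ⟩
  d * 2 + suc (2 ∸ w)   ≡⟨ +-suc (d * 2) (2 ∸ w) ⟩
  suc (d * 2 + (2 ∸ w)) ∎)
  where
  open ≤-Reasoning
  2∸-step : ∀ {w w'} → w ≤ suc w' → 2 ∸ w' ≤ suc (2 ∸ w)
  2∸-step {w' = zero}   w≤1 = s≤s (m<n⇒0<n∸m (s≤s w≤1))
  2∸-step {w' = suc w'} _   = ≤-trans (m∸n≤m 1 w') (s≤s z≤n)

potential-approach-≤ : ∀ d {w w'} → (d ≡ 0 → 2 ≤ w') → w ≤ suc w' →
                       potential (d ∸ 1) w' ≤ potential d w
potential-approach-≤ zero    heavy _      = ≤-trans (≤-reflexive (m≤n⇒m∸n≡0 (heavy refl))) z≤n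
potential-approach-≤ (suc d) _     w≤1+w' = <⇒≤ (potential-step d w≤1+w')

potential-approach-< : ∀ d {w w'} → (d ≡ 0 → 2 ≤ w' × w < 2) → w ≤ suc w' →
                       potential (d ∸ 1) w' < potential d w
potential-approach-< zero {w} onShadow _ with onShadow refl
... | heavy , light = subst (_< 2 ∸ w) (sym (m≤n⇒m∸n≡0 heavy)) (m<n⇒0<n∸m light)
potential-approach-< (suc d) _ w≤1+w' = potential-step d w≤1+w'

copPotential : ∀ {n} → ℕ → Vec Bool n → Vec Bool n → ℕ
copPotential s x r = potential (hamming x (zeroWindow s 3 r)) (weight s r)

onShadow⇒heavy : ∀ {n} s {x r : Vec Bool n} → x ≡ zeroWindow s 3 r → 2 ≤ hamming x r →
                 2 ≤ weight s r
onShadow⇒heavy s {r = r} refl far = subst (2 ≤_) (hamming-sym (zeroWindow s 3 r) r) far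

module _ {n} (s : ℕ) (x x' r r' : Vec Bool n)
         (r≈r' : hamming r r' ≤ 1) (far : 2 ≤ hamming x r')
         (approach : hamming x' (zeroWindow s 3 r') ≡ hamming x (zeroWindow s 3 r') ∸ 1) where

  private
    D = hamming x (zeroWindow s 3 r)

    shadowFixed⊎weightFixed : zeroWindow s 3 r ≡ zeroWindow s 3 r' ⊎ weight s r ≡ weight s r'
    shadowFixed⊎weightFixed with n≤1⇒n≡0∨n≡1 r≈r'
    ... | inj₁ r≡r' with refl ← hamming≡0⇒≡ {xs = r} r≡r' = inj₁ refl
    ... | inj₂ adj = zeroWindow-adjacent s 3 adj

    potential-shadowFixed : zeroWindow s 3 r ≡ zeroWindow s 3 r' →
                            copPotential s x' r' ≡ potential (D ∸ 1) (weight s r')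
    potential-shadowFixed same = cong (λ d → potential d (weight s r'))
      (trans approach (cong (λ t → hamming x t ∸ 1) (sym same)))

    onShadow⇒heavy' : zeroWindow s 3 r ≡ zeroWindow s 3 r' → D ≡ 0 → 2 ≤ weight s r'
    onShadow⇒heavy' same D≡0 = onShadow⇒heavy s (trans (hamming≡0⇒≡ {xs = x} D≡0) same) far

    weight-shadowFixed : zeroWindow s 3 r ≡ zeroWindow s 3 r' → weight s r ≤ suc (weight s r')
    weight-shadowFixed same = begin
      hamming r (zeroWindow s 3 r)                 ≤⟨ hamming-triangle r r' _ ⟩
      hamming r r' + hamming r' (zeroWindow s 3 r) ≤⟨ +-monoˡ-≤ _ r≈r' ⟩
      suc (hamming r' (zeroWindow s 3 r))          ≡⟨ cong (λ t → suc (hamming r' t)) same ⟩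
      suc (weight s r')                            ∎
      where open ≤-Reasoning

    oldShadow-near : hamming x (zeroWindow s 3 r') ≤ 1 + D
    oldShadow-near = begin
      hamming x (zeroWindow s 3 r')                      ≤⟨ hamming-triangle x (zeroWindow s 3 r) _ ⟩
      D + hamming (zeroWindow s 3 r) (zeroWindow s 3 r') ≤⟨ +-monoʳ-≤ D shadows-near ⟩
      D + 1                                              ≡⟨ +-comm D 1 ⟩
      1 + D                                              ∎
      where
      open ≤-Reasoning
      shadows-near = ≤-trans (zeroWindow-nonexpansive s 3 r r') r≈r'

  copPotential-nonincreasing : copPotential s x' r' ≤ copPotential s x r
  copPotential-nonincreasing with shadowFixed⊎weightFixed
  ... | inj₁ same rewrite potential-shadowFixed same =
    potential-approach-≤ D (onShadow⇒heavy' same) (weight-shadowFixed same)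
  ... | inj₂ sameWeight rewrite approach | sameWeight =
    potential-monoˡ-≤ (weight s r') (m≤n+o⇒m∸n≤o _ 1 oldShadow-near)

  copPotential-decreasing : NoConsec r → NoConsec r' → zeroWindow s 3 r ≡ zeroWindow s 3 r' →
                            hamming r r' ≡ 1 ⊎ 0 < D → copPotential s x' r' < copPotential s x r
  copPotential-decreasing nc nc' same moved⊎offShadow rewrite potential-shadowFixed same =
    potential-approach-< D (onShadow moved⊎offShadow) (weight-shadowFixed same)
    where
    -- A cop on the shadow forces the new weight to be 2; by parity the old one is not 2.
    onShadow : hamming r r' ≡ 1 ⊎ 0 < D → D ≡ 0 → 2 ≤ weight s r' × weight s r < 2
    onShadow (inj₂ 0<D) D≡0 = ⊥-elim (<⇒≢ 0<D (sym D≡0))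
    onShadow (inj₁ adj) D≡0 = heavy , ≤∧≢⇒< (weight≤2 s r nc) w≢2
      where
      heavy : 2 ≤ weight s r'
      heavy = onShadow⇒heavy' same D≡0
      w'≡2 : hamming r' (zeroWindow s 3 r) ≡ 2
      w'≡2 = trans (cong (hamming r') same) (≤-antisym (weight≤2 s r' nc') heavy)
      w≢2 : weight s r ≢ 2
      w≢2 w≡2 = adjacent⇒hamming≢ r r' _ adj (trans w≡2 (sym w'≡2))

sum-mono-≤ : ∀ {k} {f g : Vector ℕ k} → (∀ i → f i ≤ g i) → sum f ≤ sum g
sum-mono-≤ {zero}  f≤g = z≤n
sum-mono-≤ {suc k} f≤g = +-mono-≤ (f≤g zero) (sum-mono-≤ (f≤g ∘ suc))

sum-mono-< : ∀ {k} {f g : Vector ℕ k} → (∀ i → f i ≤ g i) → ∃[ j ] f j < g j →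
             sum f < sum g
sum-mono-< f≤g (zero  , f<g) = +-mono-<-≤ f<g (sum-mono-≤ (f≤g ∘ suc))
sum-mono-< f≤g (suc j , f<g) = +-mono-≤-< (f≤g zero) (sum-mono-< (f≤g ∘ suc) (j , f<g))

shadow : ∀ {n} → ℕ → FibVertex n → FibVertex n
shadow s (v , nc) = zeroWindow s 3 v , NoConsec-antitone (zeroWindow-≤ s 3 v) nc

chase : ∀ {n} → ℕ → FibVertex n → FibVertex n → FibVertex n
chase s x y with dist x y ≤? 1
... | yes _ = y
... | no  _ = proj₁ (stepToward x (shadow s y))

chase-move : ∀ {n} s (x y : FibVertex n) → Move (Fib n) x (chase s x y)
chase-move s x y with dist x y ≤? 1
... | yes close = close⇒Move close
... | no  _     = proj₁ (proj₂ (stepToward x (shadow s y)))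

chase-captures : ∀ {n} s (x y : FibVertex n) → dist x y ≤ 1 → chase s x y ≡ y
chase-captures s x y close with dist x y ≤? 1
... | yes _   = refl
... | no  far = ⊥-elim (far close)

chase-approaches : ∀ {n} s (x y : FibVertex n) → ¬ dist x y ≤ 1 →
                   dist (chase s x y) (shadow s y) ≡ dist x (shadow s y) ∸ 1
chase-approaches s x y far with dist x y ≤? 1
... | yes close = ⊥-elim (far close)
... | no  _     = proj₂ (proj₂ (stepToward x (shadow s y)))

p<p/3*3+3 : ∀ p → p < p / 3 * 3 + 3
p<p/3*3+3 p = begin-strict
  p                 ≡⟨ m≡m%n+[m/n]*n p 3 ⟩
  p % 3 + p / 3 * 3 <⟨ +-monoˡ-< (p / 3 * 3) (m%n<n p 3) ⟩
  3 + p / 3 * 3     ≡⟨ +-comm 3 (p / 3 * 3) ⟩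
  p / 3 * 3 + 3     ∎
  where open ≤-Reasoning

n≤⌈n/3⌉*3 : ∀ n → n ≤ ⌈ n /3⌉ * 3
n≤⌈n/3⌉*3 n = +-cancelʳ-≤ 2 n (q * 3) (begin
  n + 2               ≡⟨ m≡m%n+[m/n]*n (n + 2) 3 ⟩
  (n + 2) % 3 + q * 3 ≤⟨ +-monoˡ-≤ (q * 3) (≤-pred (m%n<n (n + 2) 3)) ⟩
  2 + q * 3           ≡⟨ +-comm 2 (q * 3) ⟩
  q * 3 + 2           ∎)
  where
  q = ⌈ n /3⌉
  open ≤-Reasoning

module Strategy (n k : ℕ) (6≤n : 6 ≤ n) (n≤k*3 : n ≤ k * 3) where

  Γ : Graph
  Γ = Fib n

  V : Set
  V = FibVertex n

  window : Fin k → ℕ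
  window i = toℕ i * 3

  p/3<k : ∀ {p} → p < n → p / 3 < k
  p/3<k p<n = m<n*o⇒m/o<n (≤-trans p<n n≤k*3)

  guard : ∀ {p} → p < n → Fin k
  guard p<n = fromℕ< (p/3<k p<n)

  window-guard : ∀ {p} (p<n : p < n) → window (guard p<n) ≡ p / 3 * 3
  window-guard p<n = cong (_* 3) (toℕ-fromℕ< (p/3<k p<n))

  respond : Cops Γ k → V → Cops Γ k
  respond c r i = chase (window i) (c i) r

  φ : Cops Γ k → V → Fin k → ℕ
  φ c r i = copPotential (window i) (proj₁ (c i)) (proj₁ r)

  Φ : Cops Γ k → V → ℕ
  Φ c r = sum (φ c r)

  Safe : Cops Γ k → V → Set
  Safe c r = ∀ i → 2 ≤ dist (c i) r

  φ-nonincreasing : ∀ c {r r'} → Move Γ r r' → Safe c r' →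
                    ∀ i → φ (respond c r') r' i ≤ φ c r i
  φ-nonincreasing c {r} {r'} move safe i =
    copPotential-nonincreasing (window i) (proj₁ (c i)) (proj₁ (respond c r' i)) (proj₁ r) (proj₁ r')
      (Move⇒dist≤1 move) (safe i) (chase-approaches (window i) (c i) r' (<⇒≱ (safe i)))

  φ-decreasing : ∀ c {r r'} i → Move Γ r r' → Safe c r' →
                 zeroWindow (window i) 3 (proj₁ r) ≡ zeroWindow (window i) 3 (proj₁ r') →
                 dist r r' ≡ 1 ⊎ 0 < dist (c i) (shadow (window i) r) →
                 φ (respond c r') r' i < φ c r i
  φ-decreasing c {r} {r'} i move safe =
    copPotential-decreasing (window i) (proj₁ (c i)) (proj₁ (respond c r' i)) (proj₁ r) (proj₁ r')
      (Move⇒dist≤1 move) (safe i) (chase-approaches (window i) (c i) r' (<⇒≱ (safe i)))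
      (proj₂ r) (proj₂ r')

  gain-robberMoves : ∀ c {r r'} → dist r r' ≡ 1 → Safe c r' →
                     ∃[ j ] φ (respond c r') r' j < φ c r j
  gain-robberMoves c {r} {r'} adj safe with adjacent⇒flipPosition adj
  ... | p , p<n , sameShadows =
    j , φ-decreasing c {r} {r'} j (inj₂ adj) safe (sameShadows (window j) 3 lo hi) (inj₁ adj)
    where
    j = guard p<n
    lo : window j ≤ p
    lo = subst (_≤ p) (sym (window-guard p<n)) (m/n*n≤m p 3)
    hi : p < window j + 3
    hi = subst (λ w → p < w + 3) (sym (window-guard p<n)) (p<p/3*3+3 p)

  offShadow⊎heavyWindow : ∀ (c : Cops Γ k) (r : V) i → 2 ≤ dist (c i) r →
                          0 < dist (c i) (shadow (window i) r) ⊎ 2 ≤ weight (window i) (proj₁ r)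
  offShadow⊎heavyWindow c r i far with 0 <? dist (c i) (shadow (window i) r)
  ... | yes 0<D = inj₁ 0<D
  ... | no  0≮D = inj₂ (onShadow⇒heavy (window i) {r = proj₁ r} onShadow far)
    where
    onShadow : proj₁ (c i) ≡ zeroWindow (window i) 3 (proj₁ r)
    onShadow = hamming≡0⇒≡ {xs = proj₁ (c i)} (n≤0⇒n≡0 (≮⇒≥ 0≮D))

  0<n : 0 < n
  0<n = ≤-trans (s≤s z≤n) 6≤n

  3<n : 3 < n
  3<n = ≤-trans (s≤s (s≤s (s≤s (s≤s z≤n)))) 6≤n

  cop₀ cop₃ : Fin k
  cop₀ = guard 0<n
  cop₃ = guard 3<n

  gain-robberStays : ∀ c r → Safe c r → ∃[ j ] φ (respond c r) r j < φ c r j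
  gain-robberStays c r safe with offShadow⊎heavyWindow c r cop₀ (safe cop₀)
                               | offShadow⊎heavyWindow c r cop₃ (safe cop₃)
  ... | inj₁ 0<D    | _        = cop₀ , φ-decreasing c {r} cop₀ (inj₁ refl) safe refl (inj₂ 0<D)
  ... | _           | inj₁ 0<D = cop₃ , φ-decreasing c {r} cop₃ (inj₁ refl) safe refl (inj₂ 0<D)
  ... | inj₂ heavy₀ | inj₂ heavy₃ = ⊥-elim (¬heavyWindows₀₃ 6≤n (proj₁ r) (proj₂ r)
          (subst (λ s → 2 ≤ weight s (proj₁ r)) (window-guard 0<n) heavy₀)
          (subst (λ s → 2 ≤ weight s (proj₁ r)) (window-guard 3<n) heavy₃))

  Φ-decreasing : ∀ c {r r'} → Move Γ r r' → Safe c r' → Φ (respond c r') r' < Φ c r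
  Φ-decreasing c {r} {r'} move safe = sum-mono-< (φ-nonincreasing c move safe) (gain move)
    where
    gain : Move Γ r r' → ∃[ j ] φ (respond c r') r' j < φ c r j
    gain (inj₁ refl) = gain-robberStays c r safe
    gain (inj₂ adj)  = gain-robberMoves c {r} {r'} adj safe

  robberTurn : ∀ m c r → Φ c r < m → RobTurn Γ c r
  robberTurn (suc m) c r Φ<1+m = rmove λ r' move →
    cmove (respond c r') (λ i → chase-move (window i) (c i) r') (afterResponse r' move)
    where
    afterResponse : ∀ r' → Move Γ r r' → RobTurn Γ (respond c r') r'
    afterResponse r' move with any? (λ i → dist (c i) r' ≤? 1)
    ... | yes (i , close) = caughtR (i , chase-captures (window i) (c i) r' close)
    ... | no  noneClose   =
      robberTurn m (respond c r') r' (<-≤-trans (Φ-decreasing c move safe) (≤-pred Φ<1+m))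
      where
      safe : Safe c r'
      safe i = ≰⇒> (λ close → noneClose (i , close))

  copsWin : CopsWin Γ k
  copsWin = start , λ r →
    cmove start (λ _ → inj₁ refl) (robberTurn (suc (Φ start r)) start r ≤-refl)
    where
    start : Cops Γ k
    start _ = replicate n false , NoConsec-zeros n

theorem4p2 : ∀ (n : ℕ) → 6 ≤ n → CopNumber≤ (Fib n) ⌈ n /3⌉
theorem4p2 n 6≤n = ⌈ n /3⌉ , ≤-refl , Strategy.copsWin n ⌈ n /3⌉ 6≤n (n≤⌈n/3⌉*3 n)
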